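{- If $G$ is a finite simple graph, then $\displaystyle\lim_{r\to\infty}\frac{Z_{(r)}(G)}{r}=Z^-(G)$.
   Context: Skew zero forcing: initially some set of vertices of $G$ is blue and the rest white; if $w$ is the only white neighbor of any vertex $u$ (blue or white), then $u$ may color $w$ blue. $Z^-(G)$ is the minimum cardinality of an initial blue set from which all vertices can be made blue. For $r\in\mathbb{N}$, the $r$-blowup $G^{(r)}$ is obtained by replacing each vertex $u$ by an independent set $R_u$ of $r$ vertices and each edge $uw$ by all edges between $R_u$ and $R_w$. $r$-fold forcing game: an initial set $B\subseteq V(G^{(r)})$ is blue, the rest white; at each step, with $B_t$ the current blue set, a vertex $u\in B_t$ with $|N(u)\setminus B_t|\le r$ colors all of $N(u)\setminus B_t$ blue. $Z_{(r)}(G)$ is the minimum cardinality of an initial blue set from which all of $G^{(r)}$ can be made blue. -}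

module Defs where

open import Data.Nat using (ℕ; zero; suc; _≤_; _*_)
open import Data.Bool using (Bool; true; false)
open import Data.Fin using (Fin; quotient)
open import Data.Fin.Subset using (Subset; _∈_; _∉_; _∪_; _∩_; ∁; ⁅_⁆; ⊤; ∣_∣)
open import Data.Vec using (tabulate)
open import Data.Product using (Σ; ∃; _×_; _,_)
open import Relation.Binary.PropositionalEquality using (_≡_; _≢_)
open import Relation.Binary.Construct.Closure.ReflexiveTransitive using (Star)

record Graph : Set where
  field
    n     : ℕ
    adj   : Fin n → Fin n → Bool
    sym   : ∀ u w → adj u w ≡ adj w u
    irrefl : ∀ u → adj u u ≡ false
open Graph public

N : (G : Graph) → Fin (n G) → Subset (n G)
N G u = tabulate (adj G u)

-- one skew force: u (of any colour) has w as its only white neighbour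
data SkewStep (G : Graph) : Subset (n G) → Subset (n G) → Set where
  force : ∀ {B} (u w : Fin (n G)) →
          adj G u w ≡ true → w ∉ B →
          (∀ x → adj G u x ≡ true → x ≢ w → x ∈ B) →
          SkewStep G B (B ∪ ⁅ w ⁆)

IsSkewZFSet : (G : Graph) → Subset (n G) → Set
IsSkewZFSet G B = Star (SkewStep G) B ⊤

-- k = Z^-(G): minimum cardinality of a skew zero forcing set
IsSkewZF : (G : Graph) → ℕ → Set
IsSkewZF G k = (∃ λ B → IsSkewZFSet G B × ∣ B ∣ ≡ k)
             × (∀ B → IsSkewZFSet G B → k ≤ ∣ B ∣)

-- r-blowup: vertex set Fin (n * r), vertex i lies in the class R_(quotient r i)

blowup : (G : Graph) → ℕ → Graph
blowup G r = record
  { n = n G * r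
  ; adj = λ i j → adj G (quotient r i) (quotient r j)
  ; sym = λ i j → sym G (quotient r i) (quotient r j)
  ; irrefl = λ i → irrefl G (quotient r i)
  }

data FoldStep (r : ℕ) (H : Graph) : Subset (n H) → Subset (n H) → Set where
  force : ∀ {B} (u : Fin (n H)) → u ∈ B →
          ∣ N H u ∩ ∁ B ∣ ≤ r →
          FoldStep r H B (B ∪ N H u)

IsFoldSet : (G : Graph) (r : ℕ) → Subset (n (blowup G r)) → Set
IsFoldSet G r B = Star (FoldStep r (blowup G r)) B ⊤

-- k = Z_(r)(G): minimum cardinality of an initial blue set in G^(r)
-- from which the r-fold forcing game colours everything
IsZr : (G : Graph) (r : ℕ) → ℕ → Set
IsZr G r k = (∃ λ B → IsFoldSet G r B × ∣ B ∣ ≡ k)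
           × (∀ B → IsFoldSet G r B → k ≤ ∣ B ∣)

-- Write k = r + 1 and n for the number of vertices of G. We show
-- k·Z⁻(G) ≤ Z_(k)(G) ≤ k·Z⁻(G) + n, so Z_(k)(G)/k is within n/k of Z⁻(G).
--
-- Upper bound: for a skew forcing set C of G, colour the classes R_v (v ∈ C)
-- and one representative of every class. A skew force u → w is simulated by
-- the representative of u, whose white neighbours all lie in R_w, hence number
-- at most k.
--
-- Lower bound: follow a k-fold forcing process on G^(k) backwards, keeping a
-- skew forcing set S of G with k·|S| ≤ |D| that contains every vertex whose
-- class is entirely blue in the current blue set D. If a vertex of R_u forces
-- some vertex of R_w, then afterwards every neighbour of u has its whole class
-- blue, so u skew-forces w from S − w; the at most k vertices coloured by the
-- force pay for removing w.

module Submission where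

module Subsets where

  open import Data.Bool using (Bool; true; false)
  open import Data.Fin using (Fin; zero; suc; quotient; remainder; combine)
  open import Data.Fin.Properties using (combine-remQuot) renaming (_≟_ to _≟ᶠ_)
  open import Data.Fin.Subset
  open import Data.Fin.Subset.Properties
  open import Data.Nat using (ℕ; suc; _+_; _*_; _≤_; z≤n; s≤s)
  open import Data.Nat.Properties using (≤-reflexive; ≤-trans; +-suc)
  open import Data.Sum using (inj₁; inj₂)
  open import Data.Vec using (Vec; []; _∷_; _++_; concat; map; lookup; replicate; tabulate; there)
  import Data.Vec.Properties as Vec
  open import Data.Vec.Properties
    using (lookup-map; lookup-replicate; lookup∘tabulate; []=⇒lookup; lookup⇒[]=)
  open import Relation.Binary.PropositionalEquality
  open import Relation.Nullary using (yes; no)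

  private
    variable
      m : ℕ

  ∣p∪q∣≤∣p∣+∣q∩∁p∣ : (p q : Subset m) → ∣ p ∪ q ∣ ≤ ∣ p ∣ + ∣ q ∩ ∁ p ∣
  ∣p∪q∣≤∣p∣+∣q∩∁p∣ []          []          = z≤n
  ∣p∪q∣≤∣p∣+∣q∩∁p∣ (true ∷ p)  (true ∷ q)  = s≤s (∣p∪q∣≤∣p∣+∣q∩∁p∣ p q)
  ∣p∪q∣≤∣p∣+∣q∩∁p∣ (true ∷ p)  (false ∷ q) = s≤s (∣p∪q∣≤∣p∣+∣q∩∁p∣ p q)
  ∣p∪q∣≤∣p∣+∣q∩∁p∣ (false ∷ p) (true ∷ q)  =
    ≤-trans (s≤s (∣p∪q∣≤∣p∣+∣q∩∁p∣ p q)) (≤-reflexive (sym (+-suc ∣ p ∣ _)))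
  ∣p∪q∣≤∣p∣+∣q∩∁p∣ (false ∷ p) (false ∷ q) = ∣p∪q∣≤∣p∣+∣q∩∁p∣ p q

  ∣p++q∣≡∣p∣+∣q∣ : ∀ {n} (p : Subset m) (q : Subset n) → ∣ p ++ q ∣ ≡ ∣ p ∣ + ∣ q ∣
  ∣p++q∣≡∣p∣+∣q∣ []          q = refl
  ∣p++q∣≡∣p∣+∣q∣ (true ∷ p)  q = cong suc (∣p++q∣≡∣p∣+∣q∣ p q)
  ∣p++q∣≡∣p∣+∣q∣ (false ∷ p) q = ∣p++q∣≡∣p∣+∣q∣ p q

  x∉p-x : ∀ (x : Fin m) p → x ∉ p - x
  x∉p-x zero    (_ ∷ p) ()
  x∉p-x (suc x) (_ ∷ p) (there x∈p-x) = x∉p-x x p x∈p-x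

  q⊆p⇒p∪q≡p : ∀ {p q : Subset m} → q ⊆ p → p ∪ q ≡ p
  q⊆p⇒p∪q≡p {p = p} {q} q⊆p = ⊆-antisym p∪q⊆p (p⊆p∪q q)
    where
    p∪q⊆p : p ∪ q ⊆ p
    p∪q⊆p x∈ with x∈p∪q⁻ p q x∈
    ... | inj₁ x∈p = x∈p
    ... | inj₂ x∈q = q⊆p x∈q

  p-x∪⁅x⁆≡p : ∀ {x : Fin m} {p} → x ∈ p → (p - x) ∪ ⁅ x ⁆ ≡ p
  p-x∪⁅x⁆≡p {x = x} {p} x∈p = ⊆-antisym ⊆p ⊇p
    where
    ⊆p : (p - x) ∪ ⁅ x ⁆ ⊆ p
    ⊆p y∈ with x∈p∪q⁻ (p - x) ⁅ x ⁆ y∈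
    ... | inj₁ y∈p-x = p─q⊆p p ⁅ x ⁆ y∈p-x
    ... | inj₂ y∈⁅x⁆ = subst (_∈ p) (sym (x∈⁅y⁆⇒x≡y x y∈⁅x⁆)) x∈p
    ⊇p : p ⊆ (p - x) ∪ ⁅ x ⁆
    ⊇p {y} y∈p with y ≟ᶠ x
    ... | yes refl = x∈p∪q⁺ (inj₂ (x∈⁅x⁆ x))
    ... | no y≢x   = x∈p∪q⁺ (inj₁ (x∈p∧x≢y⇒x∈p-y y∈p y≢x))

  ∈-tabulate⁺ : ∀ (f : Fin m → Bool) {i} → f i ≡ true → i ∈ tabulate f
  ∈-tabulate⁺ f {i} fi = lookup⇒[]= i (tabulate f) (trans (lookup∘tabulate f i) fi)

  ∈-tabulate⁻ : ∀ (f : Fin m → Bool) {i} → i ∈ tabulate f → f i ≡ true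
  ∈-tabulate⁻ f {i} i∈ = trans (sym (lookup∘tabulate f i)) ([]=⇒lookup i∈)

  lookup-concat-quotient : ∀ {a} {A : Set a} {k} (xss : Vec (Vec A k) m) i →
    lookup (concat xss) i ≡ lookup (lookup xss (quotient k i)) (remainder {m} k i)
  lookup-concat-quotient {m = m} {k = k} xss i = begin
    lookup (concat xss) i             ≡⟨ cong (lookup (concat xss)) (sym (combine-remQuot {m} k i)) ⟩
    lookup (concat xss) (combine q r) ≡⟨ Vec.lookup-concat xss q r ⟩
    lookup (lookup xss q) r           ∎
    where
    open ≡-Reasoning
    q : Fin m
    q = quotient k i
    r : Fin k
    r = remainder {m} k i

  ∈-by-lookup : ∀ {n} {p : Subset m} {q : Subset n} {i j} →
                lookup p i ≡ lookup q j → i ∈ p → j ∈ q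
  ∈-by-lookup {q = q} {j = j} eq i∈p = lookup⇒[]= j q (trans (sym eq) ([]=⇒lookup i∈p))

  classes : ∀ k → Subset m → Subset (m * k)
  classes k C = concat (map (replicate k) C)

  lookup-classes : ∀ k (C : Subset m) i → lookup (classes k C) i ≡ lookup C (quotient k i)
  lookup-classes {m} k C i = begin
    lookup (classes k C) i                   ≡⟨ lookup-concat-quotient (map (replicate k) C) i ⟩
    lookup (lookup (map (replicate k) C) q) r ≡⟨ cong (λ s → lookup s r) (lookup-map q (replicate k) C) ⟩
    lookup (replicate k (lookup C q)) r      ≡⟨ lookup-replicate r (lookup C q) ⟩
    lookup C q                               ∎
    where
    open ≡-Reasoning
    q : Fin m
    q = quotient k i
    r : Fin k
    r = remainder {m} k i

  ∈-classes⁺ : ∀ k {C : Subset m} {i} → quotient k i ∈ C → i ∈ classes k C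
  ∈-classes⁺ k {C} {i} = ∈-by-lookup (sym (lookup-classes k C i))

  ∈-classes⁻ : ∀ k {C : Subset m} {i} → i ∈ classes k C → quotient k i ∈ C
  ∈-classes⁻ k {C} {i} = ∈-by-lookup (lookup-classes k C i)

  ∣classes∣ : ∀ k (C : Subset m) → ∣ classes k C ∣ ≡ ∣ C ∣ * k
  ∣classes∣ k []          = refl
  ∣classes∣ k (true ∷ C)  =
    trans (∣p++q∣≡∣p∣+∣q∣ (⊤ {k}) (classes k C)) (cong₂ _+_ (∣⊤∣≡n k) (∣classes∣ k C))
  ∣classes∣ k (false ∷ C) =
    trans (∣p++q∣≡∣p∣+∣q∣ (⊥ {k}) (classes k C)) (cong₂ _+_ (∣⊥∣≡0 k) (∣classes∣ k C))

  representatives : ∀ m r → Subset (m * suc r)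
  representatives m r = concat (replicate m ⁅ zero ⁆)

  lookup-representatives : ∀ m r i →
    lookup (representatives m r) i ≡ lookup ⁅ zero ⁆ (remainder {m} (suc r) i)
  lookup-representatives m r i = trans (lookup-concat-quotient (replicate m ⁅ zero ⁆) i)
    (cong (λ s → lookup s (remainder {m} (suc r) i)) (lookup-replicate (quotient {m} (suc r) i) ⁅ zero ⁆))

  ∈-representatives⁺ : ∀ m r {i} → remainder {m} (suc r) i ≡ zero → i ∈ representatives m r
  ∈-representatives⁺ m r {i} r≡0 =
    ∈-by-lookup (sym (lookup-representatives m r i)) (subst (_∈ ⁅ zero ⁆) (sym r≡0) (x∈⁅x⁆ zero))

  ∣representatives∣ : ∀ m r → ∣ representatives m r ∣ ≡ m
  ∣representatives∣ 0       r = refl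
  ∣representatives∣ (suc m) r = trans (∣p++q∣≡∣p∣+∣q∣ ⁅ zero {r} ⁆ (representatives m r))
    (cong₂ _+_ (∣⁅x⁆∣≡1 (zero {r})) (∣representatives∣ m r))

module Forcing where

  open import Defs hiding (sym)
  open Subsets
  open import Data.Bool using (true)
  open import Data.Fin using (Fin; zero; quotient; combine)
  open import Data.Fin.Properties using (remQuot-combine) renaming (_≟_ to _≟ᶠ_)
  open import Data.Fin.Subset
  open import Data.Fin.Subset.Properties
  open import Data.Nat using (ℕ; suc; _+_; _*_; _≤_)
  open import Data.Nat.Properties
    using (*-identityˡ; +-cancelˡ-≤; *-monoˡ-≤; ≤-reflexive; ≤-trans; +-monoʳ-≤; +-comm; module ≤-Reasoning)
  open import Data.Product using (_,_; proj₁; proj₂)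
  open import Data.Sum using (inj₁; inj₂)
  open import Relation.Binary.PropositionalEquality
  open import Relation.Nullary using (yes; no; contradiction)
  open import Relation.Binary.Construct.Closure.ReflexiveTransitive using (Star; ε; _◅_; gmap)

  ∈-N⁺ : ∀ (G : Graph) {u w} → adj G u w ≡ true → w ∈ N G u
  ∈-N⁺ G {u} = ∈-tabulate⁺ (adj G u)

  ∈-N⁻ : ∀ (G : Graph) {u w} → w ∈ N G u → adj G u w ≡ true
  ∈-N⁻ G {u} = ∈-tabulate⁻ (adj G u)

  module _ (G : Graph) (k : ℕ) where

    private
      H : Graph
      H = blowup G k

    Saturated : Subset (n G * k) → Fin (n G) → Set
    Saturated D v = ∀ j → quotient k j ≡ v → j ∈ D

    record SkewShadow (D : Subset (n G * k)) : Set where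
      field
        shadow      : Subset (n G)
        forcing     : IsSkewZFSet G shadow
        size        : ∣ shadow ∣ * k ≤ ∣ D ∣
        saturated⊆  : ∀ v → Saturated D v → v ∈ shadow

    skewShadow-⊤ : SkewShadow ⊤
    skewShadow-⊤ = record
      { shadow     = ⊤
      ; forcing    = ε
      ; size       = ≤-reflexive (begin
          ∣ ⊤ {n G} ∣ * k  ≡⟨ cong (_* k) (∣⊤∣≡n (n G)) ⟩
          n G * k          ≡⟨ sym (∣⊤∣≡n (n G * k)) ⟩
          ∣ ⊤ {n G * k} ∣  ∎)
      ; saturated⊆ = λ _ _ → ∈⊤
      }
      where open ≡-Reasoning

    neighbour-saturated : ∀ {D} x {y} → adj G (quotient k x) y ≡ true → Saturated (D ∪ N H x) y
    neighbour-saturated {D} x a j refl = q⊆p∪q D (N H x) (∈-N⁺ H a)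

    skewShadow-force : ∀ {D} x {j} → j ∈ N H x → j ∉ D → ∣ N H x ∩ ∁ D ∣ ≤ k →
                       SkewShadow (D ∪ N H x) → SkewShadow D
    skewShadow-force {D} x {j} j∈N j∉D white≤k sh′ = record
      { shadow     = S′ - w
      ; forcing    = force u w u~w (x∉p-x w S′) (λ y u~y y≢w → x∈p∧x≢y⇒x∈p-y (neighbour∈S′ u~y) y≢w)
                     ◅ subst (IsSkewZFSet G) (sym (p-x∪⁅x⁆≡p w∈S′)) forcing′
      ; size       = +-cancelˡ-≤ k _ _ (begin
          suc ∣ S′ - w ∣ * k        ≤⟨ *-monoˡ-≤ k (x∈p⇒∣p-x∣<∣p∣ w∈S′) ⟩
          ∣ S′ ∣ * k                ≤⟨ size′ ⟩
          ∣ D ∪ N H x ∣             ≤⟨ ∣p∪q∣≤∣p∣+∣q∩∁p∣ D (N H x) ⟩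
          ∣ D ∣ + ∣ N H x ∩ ∁ D ∣   ≤⟨ +-monoʳ-≤ ∣ D ∣ white≤k ⟩
          ∣ D ∣ + k                 ≡⟨ +-comm ∣ D ∣ k ⟩
          k + ∣ D ∣                 ∎)
      ; saturated⊆ = λ v sat → x∈p∧x≢y⇒x∈p-y
          (saturated⊆′ v (λ j′ e → p⊆p∪q (N H x) (sat j′ e)))
          (λ v≡w → j∉D (sat j (sym v≡w)))
      }
      where
      open SkewShadow sh′
        renaming (shadow to S′; forcing to forcing′; size to size′; saturated⊆ to saturated⊆′)
      open ≤-Reasoning
      u w : Fin (n G)
      u = quotient k x
      w = quotient k j
      u~w : adj G u w ≡ true
      u~w = ∈-N⁻ H j∈N
      neighbour∈S′ : ∀ {y} → adj G u y ≡ true → y ∈ S′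
      neighbour∈S′ u~y = saturated⊆′ _ (neighbour-saturated x u~y)
      w∈S′ : w ∈ S′
      w∈S′ = neighbour∈S′ u~w

    skewShadow-step : ∀ {D D′} → FoldStep k H D D′ → SkewShadow D′ → SkewShadow D
    skewShadow-step {D} (force x _ white≤k) sh′ with nonempty? (N H x ∩ ∁ D)
    ... | no none = subst SkewShadow (q⊆p⇒p∪q≡p N⊆D) sh′
      where
      N⊆D : N H x ⊆ D
      N⊆D y∈N = x∉∁p⇒x∈p (λ y∈∁D → none (_ , x∈p∩q⁺ (y∈N , y∈∁D)))
    ... | yes (_ , j∈white) with x∈p∩q⁻ (N H x) (∁ D) j∈white
    ...   | j∈N , j∈∁D = skewShadow-force x j∈N (x∈∁p⇒x∉p j∈∁D) white≤k sh′

    skewShadow : ∀ {D} → IsFoldSet G k D → SkewShadow D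
    skewShadow ε        = skewShadow-⊤
    skewShadow (s ◅ ss) = skewShadow-step s (skewShadow ss)

  module _ (G : Graph) (r : ℕ) where

    private
      k : ℕ
      k = suc r
      H : Graph
      H = blowup G k

    seed : Subset (n G) → Subset (n G * k)
    seed C = classes k C ∪ representatives (n G) r

    ∣seed∣≤ : ∀ C → ∣ seed C ∣ ≤ ∣ C ∣ * k + n G
    ∣seed∣≤ C = begin
      ∣ seed C ∣                                   ≤⟨ ∣p∪q∣≤∣p∣+∣q∩∁p∣ (classes k C) reps ⟩
      ∣ classes k C ∣ + ∣ reps ∩ ∁ (classes k C) ∣  ≤⟨ +-monoʳ-≤ ∣ classes k C ∣ (∣p∩q∣≤∣p∣ reps _) ⟩
      ∣ classes k C ∣ + ∣ reps ∣                   ≡⟨ cong₂ _+_ (∣classes∣ k C) (∣representatives∣ (n G) r) ⟩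
      ∣ C ∣ * k + n G                              ∎
      where
      open ≤-Reasoning
      reps : Subset (n G * k)
      reps = representatives (n G) r

    seed-⊤ : seed ⊤ ≡ ⊤
    seed-⊤ = ⊆-antisym ⊆⊤ (λ _ → p⊆p∪q _ (∈-classes⁺ k {C = ⊤ {n G}} ∈⊤))

    representative : Fin (n G) → Fin (n G * k)
    representative u = combine u zero

    representative∈seed : ∀ C u → representative u ∈ seed C
    representative∈seed C u =
      q⊆p∪q _ _ (∈-representatives⁺ (n G) r (cong proj₂ (remQuot-combine {n G} {k} u zero)))

    adj-representative : ∀ u j → adj H (representative u) j ≡ adj G u (quotient k j)
    adj-representative u j =
      cong (λ t → adj G t (quotient k j)) (cong proj₁ (remQuot-combine {n G} {k} u zero))

    ∈-N-representative⁺ : ∀ {u j} → adj G u (quotient k j) ≡ true → j ∈ N H (representative u)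
    ∈-N-representative⁺ {u} {j} u~j = ∈-N⁺ H (trans (adj-representative u j) u~j)

    ∈-N-representative⁻ : ∀ {u j} → j ∈ N H (representative u) → adj G u (quotient k j) ≡ true
    ∈-N-representative⁻ {u} {j} j∈N = trans (sym (adj-representative u j)) (∈-N⁻ H j∈N)

    module _ {C u w} (others∈C : ∀ y → adj G u y ≡ true → y ≢ w → y ∈ C) where

      private
        x : Fin (n G * k)
        x = representative u

      white⊆class : N H x ∩ ∁ (seed C) ⊆ classes k ⁅ w ⁆
      white⊆class {j} j∈white with quotient k j ≟ᶠ w | x∈p∩q⁻ (N H x) _ j∈white
      ... | yes e   | _            = ∈-classes⁺ k (subst (_∈ ⁅ w ⁆) (sym e) (x∈⁅x⁆ w))
      ... | no  q≢w | j∈N , j∉seed = contradiction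
        (p⊆p∪q _ (∈-classes⁺ k (others∈C _ (∈-N-representative⁻ j∈N) q≢w)))
        (x∈∁p⇒x∉p j∉seed)

      ∣white∣≤k : ∣ N H x ∩ ∁ (seed C) ∣ ≤ k
      ∣white∣≤k = begin
        ∣ N H x ∩ ∁ (seed C) ∣   ≤⟨ p⊆q⇒∣p∣≤∣q∣ white⊆class ⟩
        ∣ classes k ⁅ w ⁆ ∣      ≡⟨ ∣classes∣ k ⁅ w ⁆ ⟩
        ∣ ⁅ w ⁆ ∣ * k            ≡⟨ cong (_* k) (∣⁅x⁆∣≡1 w) ⟩
        1 * k                    ≡⟨ *-identityˡ k ⟩
        k                        ∎
        where open ≤-Reasoning

      seed-grows : adj G u w ≡ true → seed C ∪ N H x ≡ seed (C ∪ ⁅ w ⁆)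
      seed-grows u~w = ⊆-antisym grown⊆ ⊆grown
        where
        neighbour∈C∪⁅w⁆ : ∀ {y} → adj G u y ≡ true → y ∈ C ∪ ⁅ w ⁆
        neighbour∈C∪⁅w⁆ {y} u~y with y ≟ᶠ w
        ... | yes refl = q⊆p∪q C _ (x∈⁅x⁆ y)
        ... | no  y≢w  = p⊆p∪q _ (others∈C y u~y y≢w)
        grown⊆ : seed C ∪ N H x ⊆ seed (C ∪ ⁅ w ⁆)
        grown⊆ {i} i∈ with x∈p∪q⁻ (seed C) (N H x) i∈
        ... | inj₂ i∈N = p⊆p∪q _ (∈-classes⁺ k (neighbour∈C∪⁅w⁆ (∈-N-representative⁻ i∈N)))
        ... | inj₁ i∈seed with x∈p∪q⁻ (classes k C) _ i∈seed
        ...   | inj₁ i∈C   = p⊆p∪q _ (∈-classes⁺ k (p⊆p∪q ⁅ w ⁆ (∈-classes⁻ k {C = C} i∈C)))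
        ...   | inj₂ i∈rep = q⊆p∪q _ _ i∈rep
        ⊆grown : seed (C ∪ ⁅ w ⁆) ⊆ seed C ∪ N H x
        ⊆grown {i} i∈ with x∈p∪q⁻ (classes k (C ∪ ⁅ w ⁆)) _ i∈
        ... | inj₂ i∈rep = p⊆p∪q _ (q⊆p∪q _ _ i∈rep)
        ... | inj₁ i∈C∪w with x∈p∪q⁻ C ⁅ w ⁆ (∈-classes⁻ k i∈C∪w)
        ...   | inj₁ q∈C = p⊆p∪q _ (p⊆p∪q _ (∈-classes⁺ k q∈C))
        ...   | inj₂ q∈w = q⊆p∪q _ _
          (∈-N-representative⁺ (subst (λ t → adj G u t ≡ true) (sym (x∈⁅y⁆⇒x≡y w q∈w)) u~w))

    seed-step : ∀ {C C′} → SkewStep G C C′ → FoldStep k H (seed C) (seed C′)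
    seed-step {C} (force u w u~w _ others∈C) =
      subst (FoldStep k H (seed C)) (seed-grows others∈C u~w)
            (force (representative u) (representative∈seed C u) (∣white∣≤k others∈C))

    seed-forcing : ∀ {C} → IsSkewZFSet G C → IsFoldSet G k (seed C)
    seed-forcing {C} forcing = subst (Star (FoldStep k H) (seed C)) seed-⊤ (gmap seed seed-step forcing)

  Z⁻*k≤Zₖ : ∀ (G : Graph) k {z Z} → IsSkewZF G z → IsZr G k Z → z * k ≤ Z
  Z⁻*k≤Zₖ G k (_ , z-minimal) ((D , forcing , refl) , _) =
    ≤-trans (*-monoˡ-≤ k (z-minimal shadow skew)) size
    where open SkewShadow (skewShadow G k forcing) renaming (forcing to skew)

  Zₖ≤Z⁻*k+n : ∀ (G : Graph) r {z Z} → IsSkewZF G z → IsZr G (suc r) Z → Z ≤ z * suc r + n G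
  Zₖ≤Z⁻*k+n G r ((C , forcing , refl) , _) (_ , Z-minimal) =
    ≤-trans (Z-minimal (seed G r C) (seed-forcing G r forcing)) (∣seed∣≤ G r C)

module Ratio where

  open import Data.Nat as ℕ using (zero; suc; _+_; _*_; _≤_; _∸_; s≤s; z≤n)
  open import Data.Nat.Properties
    using (≤-reflexive; ≤-trans; *-monoˡ-≤; m≤n*m; m+[n∸m]≡n; m+n∸m≡n; ∸-monoˡ-≤)
  open import Data.Integer as ℤ using (+_; +<+; +≤+)
  open import Data.Integer.Properties using (pos-+; pos-*; *-identityʳ)
  open import Data.Integer.Solver using (module +-*-Solver)
  open import Data.Rational as ℚ using (ℚ; mkℚ; 0ℚ; _/_; _-_; -_; ∣_∣; _<_; ↧ₙ_; toℚᵘ; *<*)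
  open import Data.Rational.Properties
    using (toℚᵘ-homo-+; toℚᵘ-homo‿-; toℚᵘ-fromℚᵘ; toℚᵘ-cancel-<; toℚᵘ-cancel-≤; 0≤p⇒∣p∣≡p)
  open import Data.Rational.Unnormalised as ℚᵘ using (mkℚᵘ; _≃_; *≡*; *≤*)
  open import Data.Rational.Unnormalised.Properties
    using (+-cong; +-congʳ; -‿cong; ≃-sym; ≤-respʳ-≃; <-respˡ-≃; module ≃-Reasoning)
  open import Relation.Binary.PropositionalEquality

  -- (z k + d)/k − z/1 = d/k cross-multiplied, in the shape produced by ℚᵘ's _+_ and _≃_.
  [z*k+d-z*k]*k≡d*k : ∀ z k d →
    (+ (z * k + d) ℤ.* + 1 ℤ.+ ℤ.- (+ z) ℤ.* + k) ℤ.* + k ≡ + d ℤ.* + (k * 1)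
  [z*k+d-z*k]*k≡d*k z k d = begin
    (+ (z * k + d) ℤ.* + 1 ℤ.+ ℤ.- (+ z) ℤ.* + k) ℤ.* + k
      ≡⟨ cong (λ A → (A ℤ.* + 1 ℤ.+ ℤ.- (+ z) ℤ.* + k) ℤ.* + k)
              (trans (pos-+ (z * k) d) (cong (ℤ._+ + d) (pos-* z k))) ⟩
    ((+ z ℤ.* + k ℤ.+ + d) ℤ.* + 1 ℤ.+ ℤ.- (+ z) ℤ.* + k) ℤ.* + k
      ≡⟨ solve 3 (λ z k d → ((z :* k :+ d) :* con (+ 1) :+ :- z :* k) :* k := d :* (k :* con (+ 1)))
               refl (+ z) (+ k) (+ d) ⟩
    + d ℤ.* (+ k ℤ.* + 1)
      ≡⟨ cong (+ d ℤ.*_) (sym (pos-* k 1)) ⟩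
    + d ℤ.* + (k * 1) ∎
    where
    open ≡-Reasoning
    open +-*-Solver

  [z*k+d]/k-z≃d/k : ∀ z r d → toℚᵘ ((+ (z * suc r + d)) / suc r - (+ z) / 1) ≃ mkℚᵘ (+ d) r
  [z*k+d]/k-z≃d/k z r d = begin
    toℚᵘ (p - q)                              ≈⟨ toℚᵘ-homo-+ p (- q) ⟩
    toℚᵘ p ℚᵘ.+ toℚᵘ (- q)                    ≈⟨ +-congʳ (toℚᵘ p) (toℚᵘ-homo‿- q) ⟩
    toℚᵘ p ℚᵘ.+ ℚᵘ.- toℚᵘ q                   ≈⟨ +-cong (toℚᵘ-fromℚᵘ p′) (-‿cong (toℚᵘ-fromℚᵘ q′)) ⟩
    p′ ℚᵘ.+ ℚᵘ.- q′                           ≈⟨ *≡* ([z*k+d-z*k]*k≡d*k z (suc r) d) ⟩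
    mkℚᵘ (+ d) r                              ∎
    where
    open ≃-Reasoning
    p′ q′ : ℚᵘ.ℚᵘ
    p′ = mkℚᵘ (+ (z * suc r + d)) r
    q′ = mkℚᵘ (+ z) 0
    p q : ℚ
    p = (+ (z * suc r + d)) / suc r
    q = (+ z) / 1

  d/k<ε : ∀ {n d r} (ε : ℚ) → 0ℚ < ε → d ≤ n → n * ↧ₙ ε ≤ r → mkℚᵘ (+ d) r ℚᵘ.< toℚᵘ ε
  d/k<ε {n} {d} {r} (mkℚ (+ suc p) q-1 _) _ d≤n n↧ε≤r =
    ℚᵘ.*<* (subst₂ ℤ._<_ (pos-* d (suc q-1)) (pos-* (suc p) (suc r)) (+<+ d↧ε<↥ε*k))
    where
    d↧ε<↥ε*k : d * suc q-1 ℕ.< suc p * suc r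
    d↧ε<↥ε*k = ≤-trans (s≤s (≤-trans (*-monoˡ-≤ (suc q-1) d≤n) n↧ε≤r)) (m≤n*m (suc r) (suc p))
  d/k<ε (mkℚ (+ zero)   _ _) (*<* (+<+ ()))
  d/k<ε (mkℚ ℤ.-[1+ _ ] _ _) (*<* ())

  ∣[z*k+d]/k-z∣<ε : ∀ {n z r d} (ε : ℚ) → 0ℚ < ε → d ≤ n → n * ↧ₙ ε ≤ r →
    ∣ (+ (z * suc r + d)) / suc r - (+ z) / 1 ∣ < ε
  ∣[z*k+d]/k-z∣<ε {z = z} {r} {d} ε 0<ε d≤n n↧ε≤r = subst (_< ε) (sym (0≤p⇒∣p∣≡p 0≤excess)) excess<ε
    where
    excess≃ : toℚᵘ ((+ (z * suc r + d)) / suc r - (+ z) / 1) ≃ mkℚᵘ (+ d) r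
    excess≃ = [z*k+d]/k-z≃d/k z r d
    0≤d/k : toℚᵘ 0ℚ ℚᵘ.≤ mkℚᵘ (+ d) r
    0≤d/k = *≤* (subst (ℤ._≤_ (+ 0)) (sym (*-identityʳ (+ d))) (+≤+ z≤n))
    0≤excess : 0ℚ ℚ.≤ (+ (z * suc r + d)) / suc r - (+ z) / 1
    0≤excess = toℚᵘ-cancel-≤ (≤-respʳ-≃ (≃-sym excess≃) 0≤d/k)
    excess<ε : (+ (z * suc r + d)) / suc r - (+ z) / 1 < ε
    excess<ε = toℚᵘ-cancel-< (<-respˡ-≃ (≃-sym excess≃) (d/k<ε ε 0<ε d≤n n↧ε≤r))

  ∣Z/k-z∣<ε : ∀ {n z r Z} (ε : ℚ) → 0ℚ < ε → z * suc r ≤ Z → Z ≤ z * suc r + n → n * ↧ₙ ε ≤ r →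
    ∣ (+ Z) / suc r - (+ z) / 1 ∣ < ε
  ∣Z/k-z∣<ε {n} {z} {r} {Z} ε 0<ε lower upper n↧ε≤r =
    subst (λ A → ∣ (+ A) / suc r - (+ z) / 1 ∣ < ε) (m+[n∸m]≡n lower)
          (∣[z*k+d]/k-z∣<ε {z = z} ε 0<ε d≤n n↧ε≤r)
    where
    d≤n : Z ∸ z * suc r ≤ n
    d≤n = ≤-trans (∸-monoˡ-≤ (z * suc r) upper) (≤-reflexive (m+n∸m≡n (z * suc r) n))

open import Defs
open import Data.Nat using (ℕ; suc; _≤_; _*_)
open import Data.Integer using (+_)
open import Data.Rational using (ℚ; 0ℚ; _/_; _-_; ∣_∣; _<_; ↧ₙ_)
open import Data.Product using (∃; _,_)
open Forcing using (Z⁻*k≤Zₖ; Zₖ≤Z⁻*k+n)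
open Ratio using (∣Z/k-z∣<ε)

corollary3p16 : (G : Graph) (z : ℕ) (Zr : ℕ → ℕ) →
    IsSkewZF G z → (∀ r → IsZr G (suc r) (Zr (suc r))) →
    ∀ (ε : ℚ) → 0ℚ < ε →
      ∃ λ (M : ℕ) → ∀ r → M ≤ r →
        ∣ (+ Zr (suc r)) / suc r - (+ z) / 1 ∣ < ε
corollary3p16 G z Zr z-spec Zr-spec ε 0<ε = n G * ↧ₙ ε , λ r M≤r →
  ∣Z/k-z∣<ε {z = z} ε 0<ε
    (Z⁻*k≤Zₖ G (suc r) z-spec (Zr-spec r))
    (Zₖ≤Z⁻*k+n G r z-spec (Zr-spec r))
    M≤r
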